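{- Let $k\geq 1$, let $p$ be a partially ordered pattern of length $k$ with partial order $<_P$ on $\{1,\dots,k\}$, and let $0\leq i\leq s\leq k$. Suppose every label in $$I=\{1,2,\dots,i\}\cup\{k-s+i+1,k-s+i+2,\dots,k\}$$ is isolated, i.e. incomparable under $<_P$ to every other label. Let $p_1$ be the partially ordered pattern of length $k-s$ obtained from $p$ by removing the labels in $I$ (that is, restricting $<_P$ to $\{i+1,\dots,k-s+i\}$) and relabeling each remaining label $j$ as $j-i$. Let $a(n)$ (resp. $b(n)$) be the number of $n$-permutations avoiding $p$ (resp. $p_1$). Then $$a(n)=\begin{cases} n! & \text{if } n<k,\\ \dfrac{n!}{(n-s)!}\, b(n-s) & \text{if } n\geq k.\end{cases}$$
   Context: An $n$-permutation is a permutation $\pi=\pi_1\cdots\pi_n$ of $\{1,\dots,n\}$ written in one-line notation (for $n=0$ there is exactly one, the empty permutation). A partially ordered pattern (POP) $p$ of length $k$ is a partial order $<_P$ on the label set $\{1,\dots,k\}$. An occurrence of $p$ in $\pi$ is a subsequence $\pi_{i_1}\pi_{i_2}\cdots\pi_{i_k}$ with $1\leq i_1<\cdots<i_k\leq n$ such that $\pi_{i_j}<\pi_{i_m}$ whenever $j<_P m$ (no condition is imposed on pairs of incomparable labels). A permutation avoids $p$ if it contains no occurrence of $p$. (Under this definition the POP of length $0$ has an occurrence, the empty subsequence, in every permutation.) -}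

module Defs where

open import Level using (0ℓ)
open import Data.Nat using (ℕ; _+_; _∸_; _/_; _<_; _≤_; _!)
open import Data.Sum using (_⊎_)
open import Data.Nat.Properties using (_!≢0)

open import Data.Fin using (Fin; toℕ)
import Data.Fin as F
open import Data.Vec using (Vec; lookup)
open import Data.List using (List; length)
open import Data.List.Relation.Unary.Unique.Propositional using (Unique)
open import Data.List.Membership.Propositional using (_∈_)
open import Data.Product using (Σ; _×_; ∃₂)
open import Function.Bundles using (_⇔_)
open import Relation.Nullary using (¬_)
open import Relation.Binary.PropositionalEquality using (_≡_)

-- A POP of length k: a relation on the labels Fin k (label j+1 ↔ index j).
-- (Being a strict partial order is imposed as a hypothesis in the theorem.)
POP : ℕ → Set₁
POP k = Fin k → Fin k → Set

-- An n-permutation in one-line notation: entries π_1..π_n as a vector of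
-- values in Fin n (value v ↔ number v+1), pairwise distinct.
IsPerm : ∀ {n} → Vec (Fin n) n → Set
IsPerm {n} v = ∀ (a b : Fin n) → lookup v a ≡ lookup v b → a ≡ b

Occurs : ∀ {k n} → POP k → Vec (Fin n) n → Set
Occurs {k} {n} p v =
  Σ (Fin k → Fin n) λ ι →
    (∀ (j m : Fin k) → j F.< m → ι j F.< ι m) ×
    (∀ (j m : Fin k) → p j m → lookup v (ι j) F.< lookup v (ι m))

Avoids : ∀ {k n} → POP k → Vec (Fin n) n → Set
Avoids p v = ¬ Occurs p v

AvoidingPerm : ∀ {k} → POP k → (n : ℕ) → Vec (Fin n) n → Set
AvoidingPerm p n v = IsPerm v × Avoids p v

-- "The predicate P on the finite set Vec (Fin n) n holds for exactly m elements":
-- there is a duplicate-free list of length m listing exactly the elements satisfying P.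
HasCount : ∀ {n} → (Vec (Fin n) n → Set) → ℕ → Set
HasCount {n} P m =
  Σ (List (Vec (Fin n) n)) λ L →
    Unique L × (∀ v → (v ∈ L) ⇔ P v) × (length L ≡ m)

Isolated : ∀ {k} → POP k → Fin k → Set
Isolated {k} p j = ∀ (m : Fin k) → ¬ p j m × ¬ p m j

InI : (k i s : ℕ) → Fin k → Set
InI k i s j = (toℕ j < i) ⊎ (k ∸ s + i ≤ toℕ j)


restrict : ∀ {k} → POP k → (i s : ℕ) → POP (k ∸ s)
restrict {k} p i s a b =
  ∃₂ λ (x y : Fin k) → toℕ x ≡ i + toℕ a × toℕ y ≡ i + toℕ b × p x y

fallingRatio : ℕ → ℕ → ℕ
fallingRatio n s = (n !) / ((n ∸ s) !)
  where instance _ = (n ∸ s) !≢0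

-- An isolated label constrains only the position of its entry, never its value. If the first
-- label of p is isolated, a permutation contains p iff the entries after its first one contain p
-- with that label deleted, because any occurrence may be moved to start at the first position;
-- symmetrically for the last label and the last entry. Splitting an (n+1)-permutation into its
-- first (or last) entry x and the standardisation σ of the other entries is a bijection onto
-- [n+1] × Sₙ, so each peeled label multiplies the number of avoiders by the current length, and
-- peeling all s labels of I gives a(n) = n (n-1) ⋯ (n-s+1) b(n-s). When n < k an occurrence
-- would need k distinct positions, so every n-permutation avoids p.
module Submission where

open import Defs
open import Data.Nat using (ℕ; zero; suc; _+_; _*_; _∸_; _!; _/_; _<_; _≤_; z≤n; s≤s; z<s)
import Data.Nat.Properties as ℕₚ
open import Data.Nat.Properties using (_!≢0)
open import Data.Nat.DivMod using (m*n/n≡m; /-congˡ; /-congʳ)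
open import Data.Fin as F using (Fin; zero; suc; toℕ; fromℕ; punchIn; punchOut)
import Data.Fin.Properties as Fₚ
open import Data.Vec as V using (Vec; []; lookup)
import Data.Vec.Properties as Vₚ
import Data.Vec.Functional as VF
import Data.Vec.Functional.Properties as VFₚ
open import Data.List as L using (length; allFin; cartesianProductWith)
import Data.List.Properties as Lₚ
import Data.List.Relation.Unary.All as All
import Data.List.Relation.Unary.AllPairs as AllPairs
import Data.List.Relation.Unary.Unique.Propositional.Properties as Uniqueₚ
open import Data.List.Relation.Unary.Any using (here)
open import Data.List.Membership.Propositional using (_∈_)
import Data.List.Membership.Propositional.Properties as ∈ₚ
open import Data.Product using (Σ; ∃; ∃₂; _×_; _,_; proj₁; proj₂)
open import Data.Sum using (_⊎_; inj₁; inj₂)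
open import Function using (_∘_; _$_)
open import Function.Bundles using (_⇔_; mk⇔; Equivalence)
import Function.Properties.Equivalence as ⇔
open import Relation.Nullary using (yes; no; contradiction)
open import Relation.Binary.PropositionalEquality
  using (_≡_; _≢_; refl; sym; trans; cong; cong₂; subst; subst₂; module ≡-Reasoning)
open import Relation.Binary.Structures using (IsStrictPartialOrder)

open Equivalence using (to; from)

HasCount-resp-⇔ : ∀ {n m} {P Q : Vec (Fin n) n → Set} →
  (∀ v → P v ⇔ Q v) → HasCount P m → HasCount Q m
HasCount-resp-⇔ P⇔Q (L , unique , L⇔P , len) = L , unique , (λ v → ⇔.trans (L⇔P v) (P⇔Q v)) , len

length-cartesianProductWith : ∀ {A B C : Set} (f : A → B → C) xs ys →
  length (cartesianProductWith f xs ys) ≡ length xs * length ys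
length-cartesianProductWith f L.[]       ys = refl
length-cartesianProductWith f (x L.∷ xs) ys = begin
  length (L.map (f x) ys L.++ cartesianProductWith f xs ys)  ≡⟨ Lₚ.length-++ (L.map (f x) ys) ⟩
  length (L.map (f x) ys) + length (cartesianProductWith f xs ys)
    ≡⟨ cong₂ _+_ (Lₚ.length-map (f x) ys) (length-cartesianProductWith f xs ys) ⟩
  length ys + length xs * length ys                          ∎
  where open ≡-Reasoning

HasCount-product : ∀ {m n n'} {P : Vec (Fin n') n' → Set} {Q : Vec (Fin n) n → Set}
  (f : Fin m → Vec (Fin n) n → Vec (Fin n') n') →
  (∀ {x x' σ σ'} → f x σ ≡ f x' σ' → x ≡ x' × σ ≡ σ') →
  (∀ π → P π ⇔ (∃₂ λ x σ → Q σ × π ≡ f x σ)) →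
  ∀ {b} → HasCount Q b → HasCount P (m * b)
HasCount-product {m} {Q = Q} f f-injective P⇔image (L , unique , L⇔Q , len) =
  cartesianProductWith f (allFin m) L ,
  Uniqueₚ.cartesianProductWith⁺ f f-injective (Uniqueₚ.allFin⁺ m) unique ,
  (λ π → ⇔.trans (mk⇔ ∈⇒image image⇒∈) (⇔.sym (P⇔image π))) ,
  trans (length-cartesianProductWith f (allFin m) L) (cong₂ _*_ (Lₚ.length-tabulate {n = m} _) len)
  where
  ∈⇒image : ∀ {π} → π ∈ cartesianProductWith f (allFin m) L → ∃₂ λ x σ → Q σ × π ≡ f x σ
  ∈⇒image π∈ with x , σ , _ , σ∈L , π≡ ← ∈ₚ.∈-cartesianProductWith⁻ f (allFin m) L π∈ =
    x , σ , to (L⇔Q σ) σ∈L , π≡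
  image⇒∈ : ∀ {π} → (∃₂ λ x σ → Q σ × π ≡ f x σ) → π ∈ cartesianProductWith f (allFin m) L
  image⇒∈ (x , σ , Qσ , refl) = ∈ₚ.∈-cartesianProductWith⁺ f (∈ₚ.∈-allFin x) (from (L⇔Q σ) Qσ)

-- Decomposing a permutation at a position

punchIn-view : ∀ {n} (t c : Fin (suc n)) → c ≡ t ⊎ ∃ λ a → c ≡ punchIn t a
punchIn-view t c with t F.≟ c
... | yes refl = inj₁ refl
... | no  t≢c  = inj₂ (punchOut t≢c , sym (Fₚ.punchIn-punchOut t≢c))

lookup-ext : ∀ {A : Set} {n} {u v : Vec A n} → (∀ a → lookup u a ≡ lookup v a) → u ≡ v
lookup-ext {u = u} {v} u≗v =
  trans (sym (Vₚ.tabulate∘lookup u)) (trans (Vₚ.tabulate-cong u≗v) (Vₚ.tabulate∘lookup v))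

insertEntry : ∀ {n} → Fin (suc n) → Fin (suc n) → Vec (Fin n) n → Vec (Fin (suc n)) (suc n)
insertEntry t x σ = V.insertAt (V.map (punchIn x) σ) t x

module _ {n : ℕ} (t : Fin (suc n)) where

  lookup-insertEntry-here : ∀ x σ → lookup (insertEntry t x σ) t ≡ x
  lookup-insertEntry-here x σ = Vₚ.insertAt-lookup (V.map (punchIn x) σ) t x

  lookup-insertEntry-punchIn : ∀ x σ a →
    lookup (insertEntry t x σ) (punchIn t a) ≡ punchIn x (lookup σ a)
  lookup-insertEntry-punchIn x σ a =
    trans (Vₚ.insertAt-punchIn (V.map (punchIn x) σ) t x a) (Vₚ.lookup-map a (punchIn x) σ)

  insertEntry-injective : ∀ {x x' σ σ'} → insertEntry t x σ ≡ insertEntry t x' σ' → x ≡ x' × σ ≡ σ'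
  insertEntry-injective {x} {x'} {σ} {σ'} eq = x≡x' , σ≡σ' x≡x'
    where
    at : ∀ c → lookup (insertEntry t x σ) c ≡ lookup (insertEntry t x' σ') c
    at c = cong (λ π → lookup π c) eq
    x≡x' : x ≡ x'
    x≡x' = trans (sym (lookup-insertEntry-here x σ)) (trans (at t) (lookup-insertEntry-here x' σ'))
    σ≡σ' : x ≡ x' → σ ≡ σ'
    σ≡σ' refl = lookup-ext λ a → Fₚ.punchIn-injective x _ _ $
      trans (sym (lookup-insertEntry-punchIn x σ a))
            (trans (at (punchIn t a)) (lookup-insertEntry-punchIn x σ' a))

  insertEntry-isPerm : ∀ x σ → IsPerm σ → IsPerm (insertEntry t x σ)
  insertEntry-isPerm x σ σ-perm c d eq with punchIn-view t c | punchIn-view t d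
  ... | inj₁ refl       | inj₁ refl       = refl
  ... | inj₁ refl       | inj₂ (b , refl) =
    contradiction (trans (sym (lookup-insertEntry-punchIn x σ b))
                         (trans (sym eq) (lookup-insertEntry-here x σ)))
                  (Fₚ.punchInᵢ≢i x (lookup σ b))
  ... | inj₂ (a , refl) | inj₁ refl       =
    contradiction (trans (sym (lookup-insertEntry-punchIn x σ a))
                         (trans eq (lookup-insertEntry-here x σ)))
                  (Fₚ.punchInᵢ≢i x (lookup σ a))
  ... | inj₂ (a , refl) | inj₂ (b , refl) = cong (punchIn t) $ σ-perm a b $ Fₚ.punchIn-injective x _ _ $
    trans (sym (lookup-insertEntry-punchIn x σ a)) (trans eq (lookup-insertEntry-punchIn x σ b))

  isPerm⇒insertEntry : ∀ π → IsPerm π → ∃₂ λ x σ → IsPerm σ × π ≡ insertEntry t x σ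
  isPerm⇒insertEntry π π-perm = x , σ , σ-perm , lookup-ext π≗
    where
    x = lookup π t
    x≢ : ∀ a → x ≢ lookup π (punchIn t a)
    x≢ a eq = Fₚ.punchInᵢ≢i t a (sym (π-perm t (punchIn t a) eq))
    entry : Fin n → Fin n
    entry a = punchOut (x≢ a)
    σ = V.tabulate entry
    σ-perm : IsPerm σ
    σ-perm a b eq = Fₚ.punchIn-injective t a b $ π-perm _ _ $ Fₚ.punchOut-injective (x≢ a) (x≢ b) $
      trans (sym (Vₚ.lookup∘tabulate entry a)) (trans eq (Vₚ.lookup∘tabulate entry b))
    π≗ : ∀ c → lookup π c ≡ lookup (insertEntry t x σ) c
    π≗ c with punchIn-view t c
    ... | inj₁ refl       = sym (lookup-insertEntry-here x σ)
    ... | inj₂ (a , refl) = sym $ begin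
      lookup (insertEntry t x σ) (punchIn t a)  ≡⟨ lookup-insertEntry-punchIn x σ a ⟩
      punchIn x (lookup σ a)                    ≡⟨ cong (punchIn x) (Vₚ.lookup∘tabulate entry a) ⟩
      punchIn x (entry a)                       ≡⟨ Fₚ.punchIn-punchOut (x≢ a) ⟩
      lookup π (punchIn t a)                    ∎
      where open ≡-Reasoning

  isPerm⇔insertEntry : ∀ π → IsPerm π ⇔ (∃₂ λ x σ → IsPerm σ × π ≡ insertEntry t x σ)
  isPerm⇔insertEntry π =
    mk⇔ (isPerm⇒insertEntry π) λ { (x , σ , σ-perm , refl) → insertEntry-isPerm x σ σ-perm }

isPerm-count : ∀ n → HasCount (IsPerm {n}) (n !)
isPerm-count zero =
  [] L.∷ L.[] , All.[] AllPairs.∷ AllPairs.[] , (λ { [] → mk⇔ (λ _ ()) (λ _ → here refl) }) , refl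
isPerm-count (suc n) =
  HasCount-product (insertEntry zero) (insertEntry-injective zero) (isPerm⇔insertEntry zero)
                   (isPerm-count n)

Increasing : ∀ {k n} → (Fin k → Fin n) → Set
Increasing {k} ι = ∀ (j m : Fin k) → j F.< m → ι j F.< ι m

-- Occurs p v unfolds to OccursIn p (lookup v).
OccursIn : ∀ {k n V} → POP k → (Fin n → Fin V) → Set
OccursIn {k} {n} p G = Σ (Fin k → Fin n) λ ι → Increasing ι × (∀ j m → p j m → G (ι j) F.< G (ι m))

punchIn-< : ∀ {n} (x : Fin (suc n)) {a b : Fin n} → a F.< b → punchIn x a F.< punchIn x b
punchIn-< x {a} {b} a<b =
  Fₚ.≤∧≢⇒< (Fₚ.punchIn-mono-≤ x a b (ℕₚ.<⇒≤ a<b)) (Fₚ.<⇒≢ a<b ∘ Fₚ.punchIn-injective x a b)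

punchIn-cancel-< : ∀ {n} (x : Fin (suc n)) {a b : Fin n} → punchIn x a F.< punchIn x b → a F.< b
punchIn-cancel-< x {a} {b} lt = ℕₚ.≰⇒> λ b≤a → ℕₚ.<⇒≱ lt (Fₚ.punchIn-mono-≤ x b a b≤a)

module _ {k n V : ℕ} {p : POP k} where

  OccursIn-cong : {G H : Fin n → Fin V} → (∀ c → G c ≡ H c) → OccursIn p G ⇔ OccursIn p H
  OccursIn-cong G≗H = mk⇔ (transport G≗H) (transport (sym ∘ G≗H))
    where
    transport : ∀ {G H : Fin n → Fin V} → (∀ c → G c ≡ H c) → OccursIn p G → OccursIn p H
    transport G≗H (ι , inc , resp) =
      ι , inc , λ j m pjm → subst₂ F._<_ (G≗H (ι j)) (G≗H (ι m)) (resp j m pjm)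

  OccursIn-punchIn : (x : Fin (suc V)) (G : Fin n → Fin V) → OccursIn p G ⇔ OccursIn p (punchIn x ∘ G)
  OccursIn-punchIn x G =
    mk⇔ (λ (ι , inc , resp) → ι , inc , λ j m pjm → punchIn-< x (resp j m pjm))
        (λ (ι , inc , resp) → ι , inc , λ j m pjm → punchIn-cancel-< x (resp j m pjm))

  OccursIn-punchOut : {G : Fin (suc n) → Fin V} (t : Fin (suc n)) ((ι , _) : OccursIn p G) →
    (∀ j → t ≢ ι j) → OccursIn p (G ∘ punchIn t)
  OccursIn-punchOut {G} t (ι , inc , resp) t≢ι = κ , κ-inc , κ-resp
    where
    κ : Fin k → Fin n
    κ j = punchOut (t≢ι j)
    punchIn-κ : ∀ j → ι j ≡ punchIn t (κ j)
    punchIn-κ j = sym (Fₚ.punchIn-punchOut (t≢ι j))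
    κ-inc : Increasing κ
    κ-inc j m j<m = punchIn-cancel-< t (subst₂ F._<_ (punchIn-κ j) (punchIn-κ m) (inc j m j<m))
    κ-resp : ∀ j m → p j m → G (punchIn t (κ j)) F.< G (punchIn t (κ m))
    κ-resp j m pjm = subst₂ (λ c d → G c F.< G d) (punchIn-κ j) (punchIn-κ m) (resp j m pjm)

OccursIn-⊆ : ∀ {k n V} {p q : POP k} {G : Fin n → Fin V} →
  (∀ a b → q a b → p a b) → OccursIn p G → OccursIn q G
OccursIn-⊆ q⊆p (ι , inc , resp) = ι , inc , λ j m qjm → resp j m (q⊆p j m qjm)

avoiders-resp-⇔ : ∀ {k n b} {p q : POP k} → (∀ x y → p x y ⇔ q x y) →
  HasCount (AvoidingPerm p n) b → HasCount (AvoidingPerm q n) b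
avoiders-resp-⇔ p⇔q = HasCount-resp-⇔ λ π →
  mk⇔ (λ (π-perm , π-avoids) → π-perm , π-avoids ∘ OccursIn-⊆ {G = lookup π} (λ x y → to (p⇔q x y)))
      (λ (π-perm , π-avoids) → π-perm , π-avoids ∘ OccursIn-⊆ {G = lookup π} (λ x y → from (p⇔q x y)))

module _ {k k' n : ℕ} {p : POP k} {q : POP k'} (t : Fin (suc n))
  (p⇔q : ∀ (G : Fin (suc n) → Fin (suc n)) → OccursIn p G ⇔ OccursIn q (G ∘ punchIn t)) where

  Occurs-insertEntry : ∀ x σ → Occurs p (insertEntry t x σ) ⇔ Occurs q σ
  Occurs-insertEntry x σ =
    ⇔.trans (p⇔q (lookup (insertEntry t x σ)))
   (⇔.trans (OccursIn-cong (lookup-insertEntry-punchIn t x σ))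
            (⇔.sym (OccursIn-punchIn x (lookup σ))))

  avoiders-step : ∀ {b} → HasCount (AvoidingPerm q n) b → HasCount (AvoidingPerm p (suc n)) (suc n * b)
  avoiders-step = HasCount-product (insertEntry t) (insertEntry-injective t) avoiding⇔insertEntry
    where
    avoiding⇔insertEntry : ∀ π →
      AvoidingPerm p (suc n) π ⇔ (∃₂ λ x σ → AvoidingPerm q n σ × π ≡ insertEntry t x σ)
    avoiding⇔insertEntry π = mk⇔ decompose compose
      where
      decompose : AvoidingPerm p (suc n) π → ∃₂ λ x σ → AvoidingPerm q n σ × π ≡ insertEntry t x σ
      decompose (π-perm , π-avoids) with x , σ , σ-perm , refl ← isPerm⇒insertEntry t π π-perm =
        x , σ , (σ-perm , π-avoids ∘ from (Occurs-insertEntry x σ)) , refl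
      compose : (∃₂ λ x σ → AvoidingPerm q n σ × π ≡ insertEntry t x σ) → AvoidingPerm p (suc n) π
      compose (x , σ , (σ-perm , σ-avoids) , refl) =
        insertEntry-isPerm t x σ σ-perm , σ-avoids ∘ to (Occurs-insertEntry x σ)

-- Removing an isolated label at an end of the pattern

data End {k n : ℕ} : Fin (suc k) → Fin (suc n) → Set where
  first : End zero zero
  last  : End (fromℕ k) (fromℕ n)

deleteLabel : ∀ {k} → POP (suc k) → Fin (suc k) → POP k
deleteLabel p ℓ a b = p (punchIn ℓ a) (punchIn ℓ b)

punchIn-fromℕ-< : ∀ {n} (a : Fin n) → punchIn (fromℕ n) a F.< fromℕ n
punchIn-fromℕ-< {n} a = Fₚ.≤∧≢⇒< (Fₚ.≤fromℕ _) (Fₚ.punchInᵢ≢i (fromℕ n) a)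

module _ {k n : ℕ} {ℓ : Fin (suc k)} {t : Fin (suc n)} where

  End-avoids : End ℓ t → {ι : Fin (suc k) → Fin (suc n)} → Increasing ι → ∀ j → t ≢ ι (punchIn ℓ j)
  End-avoids first {ι} inc j t≡ = ℕₚ.n≮0 (subst (ι zero F.<_) (sym t≡) (inc zero (suc j) z<s))
  End-avoids last  {ι} inc j t≡ =
    ℕₚ.<⇒≱ (subst (F._< ι ℓ) (sym t≡) (inc _ ℓ (punchIn-fromℕ-< j))) (Fₚ.≤fromℕ (ι ℓ))

  End-before : End ℓ t → ∀ {a} c → ℓ F.< punchIn ℓ a → t F.< punchIn t c
  End-before first c _   = z<s
  End-before last  c ℓ<a = contradiction (punchIn-fromℕ-< _) (ℕₚ.<-asym ℓ<a)

  End-after : End ℓ t → ∀ {a} c → punchIn ℓ a F.< ℓ → punchIn t c F.< t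
  End-after first c ()
  End-after last  c _ = punchIn-fromℕ-< c

  extendAt : (Fin k → Fin n) → Fin (suc k) → Fin (suc n)
  extendAt κ = VF.insertAt (punchIn t ∘ κ) ℓ t

  extendAt-here : ∀ κ → extendAt κ ℓ ≡ t
  extendAt-here κ = VFₚ.insertAt-lookup (punchIn t ∘ κ) ℓ t

  extendAt-punchIn : ∀ κ a → extendAt κ (punchIn ℓ a) ≡ punchIn t (κ a)
  extendAt-punchIn κ = VFₚ.insertAt-punchIn (punchIn t ∘ κ) ℓ t

  extendAt-increasing : End ℓ t → ∀ {κ} → Increasing κ → Increasing (extendAt κ)
  extendAt-increasing end {κ} κ-inc a b a<b with punchIn-view ℓ a | punchIn-view ℓ b
  ... | inj₁ refl        | inj₁ refl        = contradiction a<b (Fₚ.<-irrefl refl)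
  ... | inj₁ refl        | inj₂ (b' , refl)
    rewrite extendAt-here κ | extendAt-punchIn κ b' = End-before end (κ b') a<b
  ... | inj₂ (a' , refl) | inj₁ refl
    rewrite extendAt-here κ | extendAt-punchIn κ a' = End-after end (κ a') a<b
  ... | inj₂ (a' , refl) | inj₂ (b' , refl)
    rewrite extendAt-punchIn κ a' | extendAt-punchIn κ b' = punchIn-< t (κ-inc a' b' (punchIn-cancel-< ℓ a<b))

  OccursIn-deleteLabel : End ℓ t → {p : POP (suc k)} → Isolated p ℓ → ∀ {V} (G : Fin (suc n) → Fin V) →
    OccursIn p G ⇔ OccursIn (deleteLabel p ℓ) (G ∘ punchIn t)
  OccursIn-deleteLabel end {p} ℓ-isolated G = mk⇔ shrink extend
    where
    shrink : OccursIn p G → OccursIn (deleteLabel p ℓ) (G ∘ punchIn t)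
    shrink (ι , inc , resp) = OccursIn-punchOut {G = G} t
      (ι ∘ punchIn ℓ , (λ j m j<m → inc _ _ (punchIn-< ℓ j<m)) , (λ j m → resp _ _))
      (End-avoids end inc)
    extend : OccursIn (deleteLabel p ℓ) (G ∘ punchIn t) → OccursIn p G
    extend (κ , κ-inc , κ-resp) = extendAt κ , extendAt-increasing end κ-inc , resp
      where
      resp : ∀ a b → p a b → G (extendAt κ a) F.< G (extendAt κ b)
      resp a b pab with punchIn-view ℓ a | punchIn-view ℓ b
      ... | inj₁ refl        | _                = contradiction pab (proj₁ (ℓ-isolated b))
      ... | inj₂ _           | inj₁ refl        = contradiction pab (proj₂ (ℓ-isolated a))
      ... | inj₂ (a' , refl) | inj₂ (b' , refl)
        rewrite extendAt-punchIn κ a' | extendAt-punchIn κ b' = κ-resp a' b' pab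

-- Peeling off the isolated labels

toℕ-punchIn-fromℕ : ∀ {n} (a : Fin n) → toℕ (punchIn (fromℕ n) a) ≡ toℕ a
toℕ-punchIn-fromℕ zero    = refl
toℕ-punchIn-fromℕ (suc a) = cong suc (toℕ-punchIn-fromℕ a)

deleteLabel-isolated : ∀ {k} (p : POP (suc k)) ℓ {j} →
  Isolated p (punchIn ℓ j) → Isolated (deleteLabel p ℓ) j
deleteLabel-isolated p ℓ isolated m = isolated (punchIn ℓ m)

restrict-zero : ∀ {k} (p : POP k) a b → restrict p 0 0 a b ⇔ p a b
restrict-zero p a b = mk⇔
  (λ (x , y , x≡a , y≡b , pxy) → subst₂ p (Fₚ.toℕ-injective x≡a) (Fₚ.toℕ-injective y≡b) pxy)
  (λ pab → a , b , refl , refl , pab)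

restrict-deleteFirst : ∀ {k} (p : POP (suc k)) i s a b →
  restrict (deleteLabel p zero) i s a b ⇔ restrict p (suc i) (suc s) a b
restrict-deleteFirst p i s a b = mk⇔
  (λ (x , y , x≡ , y≡ , pxy) → suc x , suc y , cong suc x≡ , cong suc y≡ , pxy)
  unshift
  where
  unshift : restrict p (suc i) (suc s) a b → restrict (deleteLabel p zero) i s a b
  unshift (suc x , suc y , x≡ , y≡ , pxy) = x , y , ℕₚ.suc-injective x≡ , ℕₚ.suc-injective y≡ , pxy

restrict-deleteLast : ∀ {k} (p : POP (suc k)) s a b →
  restrict (deleteLabel p (fromℕ k)) 0 s a b ⇔ restrict p 0 (suc s) a b
restrict-deleteLast {k} p s a b = mk⇔
  (λ (x , y , x≡ , y≡ , pxy) →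
    punchIn (fromℕ k) x , punchIn (fromℕ k) y ,
    trans (toℕ-punchIn-fromℕ x) x≡ , trans (toℕ-punchIn-fromℕ y) y≡ , pxy)
  unshift
  where
  below : ∀ (x : Fin (suc k)) (c : Fin (k ∸ s)) → toℕ x ≡ toℕ c →
    ∃ λ x' → x ≡ punchIn (fromℕ k) x' × toℕ x' ≡ toℕ c
  below x c x≡c with punchIn-view (fromℕ k) x
  ... | inj₁ refl = contradiction (ℕₚ.<-≤-trans (Fₚ.toℕ<n c) (ℕₚ.m∸n≤m k s))
                                  (ℕₚ.≤⇒≯ (ℕₚ.≤-reflexive (trans (sym (Fₚ.toℕ-fromℕ k)) x≡c)))
  ... | inj₂ (x' , refl) = x' , refl , trans (sym (toℕ-punchIn-fromℕ x')) x≡c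
  unshift : restrict p 0 (suc s) a b → restrict (deleteLabel p (fromℕ k)) 0 s a b
  unshift (x , y , x≡ , y≡ , pxy)
    with x' , refl , x'≡ ← below x a x≡ | y' , refl , y'≡ ← below y b y≡ = x' , y' , x'≡ , y'≡ , pxy

InI-suc : ∀ {k i s} {j : Fin k} → InI k i s j → InI (suc k) (suc i) (suc s) (suc j)
InI-suc (inj₁ j<i) = inj₁ (s≤s j<i)
InI-suc {k} {i} {s} {j} (inj₂ j≥) = inj₂ (subst (_≤ suc (toℕ j)) (sym (ℕₚ.+-suc (k ∸ s) i)) (s≤s j≥))

InI-punchIn-fromℕ : ∀ {k s} {j : Fin k} → InI k 0 s j → InI (suc k) 0 (suc s) (punchIn (fromℕ k) j)
InI-punchIn-fromℕ {k} {s} {j} (inj₂ j≥) = inj₂ (subst (k ∸ s + 0 ≤_) (sym (toℕ-punchIn-fromℕ j)) j≥)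

fromℕ-InI : ∀ k s → InI (suc k) 0 (suc s) (fromℕ k)
fromℕ-InI k s = inj₂ (subst (k ∸ s + 0 ≤_) (sym (Fₚ.toℕ-fromℕ k))
                             (ℕₚ.≤-trans (ℕₚ.≤-reflexive (ℕₚ.+-identityʳ (k ∸ s))) (ℕₚ.m∸n≤m k s)))

fallingFactorial : ℕ → ℕ → ℕ
fallingFactorial n       zero    = 1
fallingFactorial zero    (suc s) = 0
fallingFactorial (suc n) (suc s) = suc n * fallingFactorial n s

fallingFactorial-* : ∀ s m → fallingFactorial (s + m) s * m ! ≡ (s + m) !
fallingFactorial-* zero    m = ℕₚ.*-identityˡ (m !)
fallingFactorial-* (suc s) m = begin
  suc (s + m) * fallingFactorial (s + m) s * m !
    ≡⟨ ℕₚ.*-assoc (suc (s + m)) (fallingFactorial (s + m) s) (m !) ⟩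
  suc (s + m) * (fallingFactorial (s + m) s * m !)  ≡⟨ cong (suc (s + m) *_) (fallingFactorial-* s m) ⟩
  suc (s + m) * (s + m) !                           ∎
  where open ≡-Reasoning

fallingRatio-+ : ∀ s m → fallingRatio (s + m) s ≡ fallingFactorial (s + m) s
fallingRatio-+ s m = begin
  (s + m) ! / (s + m ∸ s) !                       ≡⟨ /-congʳ (cong _! (ℕₚ.m+n∸m≡n s m)) ⟩
  (s + m) ! / m !                                 ≡⟨ /-congˡ (sym (fallingFactorial-* s m)) ⟩
  fallingFactorial (s + m) s * m ! / m !          ≡⟨ m*n/n≡m (fallingFactorial (s + m) s) (m !) ⟩
  fallingFactorial (s + m) s                      ∎
  where
  open ≡-Reasoning
  instance
    _ = m !≢0
    _ = (s + m ∸ s) !≢0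

peel : ∀ s m {b k} {p : POP (suc k)} {ℓ : Fin (suc k)} {t : Fin (suc (s + m))} → End ℓ t → Isolated p ℓ →
  HasCount (AvoidingPerm (deleteLabel p ℓ) (s + m)) (fallingFactorial (s + m) s * b) →
  HasCount (AvoidingPerm p (suc s + m)) (fallingFactorial (suc s + m) (suc s) * b)
peel s m {b} {t = t} end ℓ-isolated count =
  subst (HasCount _) (sym (ℕₚ.*-assoc (suc (s + m)) (fallingFactorial (s + m) s) b))
        (avoiders-step t (OccursIn-deleteLabel end ℓ-isolated) count)

avoiders-count : ∀ s i → i ≤ s → ∀ {k} (p : POP k) → s ≤ k → (∀ j → InI k i s j → Isolated p j) →
  ∀ m {b} → HasCount (AvoidingPerm (restrict p i s) m) b →
  HasCount (AvoidingPerm p (s + m)) (fallingFactorial (s + m) s * b)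
avoiders-count zero .zero z≤n p _ _ m {b} count =
  subst (HasCount _) (sym (ℕₚ.+-identityʳ b)) (avoiders-resp-⇔ (restrict-zero p) count)
avoiders-count (suc s) (suc i) (s≤s i≤s) {suc k} p (s≤s s≤k) isolated m count =
  peel s m first (isolated zero (inj₁ z<s)) $
    avoiders-count s i i≤s (deleteLabel p zero) s≤k
      (λ j j∈I → deleteLabel-isolated p zero (isolated (suc j) (InI-suc {s = s} j∈I))) m
      (avoiders-resp-⇔ (λ a b → ⇔.sym (restrict-deleteFirst p i s a b)) count)
avoiders-count (suc s) zero z≤n {suc k} p (s≤s s≤k) isolated m count =
  peel s m last (isolated (fromℕ k) (fromℕ-InI k s)) $
    avoiders-count s zero z≤n (deleteLabel p (fromℕ k)) s≤k
      (λ j j∈I → deleteLabel-isolated p (fromℕ k) (isolated _ (InI-punchIn-fromℕ {s = s} j∈I))) m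
      (avoiders-resp-⇔ (λ a b → ⇔.sym (restrict-deleteLast p s a b)) count)

Avoids-shorter : ∀ {k n} (p : POP k) → n < k → (π : Vec (Fin n) n) → Avoids p π
Avoids-shorter p n<k π (ι , inc , _) with a , c , a<c , ιa≡ιc ← Fₚ.pigeonhole n<k ι =
  Fₚ.<-irrefl ιa≡ιc (inc a c a<c)

theorem4 : (k : ℕ) → 1 ≤ k → (p : POP k) → IsStrictPartialOrder _≡_ p →
    (i s : ℕ) → i ≤ s → s ≤ k →
    (∀ (j : Fin k) → InI k i s j → Isolated p j) →
    ((n : ℕ) → n < k → HasCount (AvoidingPerm p n) (n !)) ×
    ((n : ℕ) → k ≤ n → (b : ℕ) → HasCount (AvoidingPerm (restrict p i s) (n ∸ s)) b →
      HasCount (AvoidingPerm p n) (fallingRatio n s * b))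
theorem4 k _ p _ i s i≤s s≤k isolated = short , long
  where
  short : ∀ n → n < k → HasCount (AvoidingPerm p n) (n !)
  short n n<k = HasCount-resp-⇔ (λ π → mk⇔ (_, Avoids-shorter p n<k π) proj₁) (isPerm-count n)
  long : ∀ n → k ≤ n → ∀ b → HasCount (AvoidingPerm (restrict p i s) (n ∸ s)) b →
    HasCount (AvoidingPerm p n) (fallingRatio n s * b)
  long n k≤n b count =
    subst (λ N → HasCount (AvoidingPerm p N) (fallingRatio N s * b))
          (ℕₚ.m+[n∸m]≡n (ℕₚ.≤-trans s≤k k≤n)) $
    subst (λ c → HasCount (AvoidingPerm p (s + (n ∸ s))) (c * b)) (sym (fallingRatio-+ s (n ∸ s))) $
    avoiders-count s i i≤s p s≤k isolated (n ∸ s) count
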